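{- Let $C_n$ ($n\ge3$) be a directed cycle graph that has a global sink. Then $C_n$ contains at most one double chain subgraph.
   Context: A directed cycle graph on $n$ vertices has, for each cyclically consecutive pair of vertices, exactly one arrow, either one-directional or bi-directional; a bi-directional arrow between $u,w$ counts as an arrow from $u$ to $w$ and one from $w$ to $u$. A sink is a vertex with no outgoing arrows (including bi-directional ones); a global sink is a sink $v$ such that every other vertex has a directed path to $v$. A double chain of length $k\ge1$ is a directed graph whose underlying graph is a path on vertices $v_0,v_1,\dots,v_{k+1}$, with arrows: a one-directional arrow $v_1\to v_0$, bi-directional arrows $v_i\leftrightarrow v_{i+1}$ for $1\le i\le k-1$, and a one-directional arrow $v_k\to v_{k+1}$. -}

module Defs where

open import Data.Nat using (ℕ; zero; suc; _+_; _≤_; _<_)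
open import Data.Nat.DivMod using (_mod_)
open import Data.Fin using (Fin; toℕ; inject₁) renaming (suc to fsuc)
open import Data.Product using (Σ; ∃; _×_)
open import Data.Sum using (_⊎_)
open import Relation.Binary.PropositionalEquality using (_≡_; _≢_)
open import Relation.Nullary using (¬_)
open import Relation.Binary.Construct.Closure.ReflexiveTransitive using (Star)
open import Function.Bundles using (_⇔_)
open import Data.Unit using (⊤)
open import Data.Empty using (⊥)

-- Orientation of the arrow on the cycle edge {i, i+1 mod n}:
--   fwd  : one-directional i → i+1
--   bwd  : one-directional i+1 → i
--   both : bi-directional
data Dir : Set where
  fwd bwd both : Dir

CycleGraph : ℕ → Set
CycleGraph n = Fin n → Dir

next : ∀ {n} → Fin n → Fin n
next {suc m} i = suc (toℕ i) mod suc m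

HasFwd : Dir → Set
HasFwd fwd  = ⊤
HasFwd bwd  = ⊥
HasFwd both = ⊤

HasBwd : Dir → Set
HasBwd fwd  = ⊥
HasBwd bwd  = ⊤
HasBwd both = ⊤

Arrow : ∀ {n} → CycleGraph n → Fin n → Fin n → Set
Arrow C u w = (w ≡ next u × HasFwd (C u)) ⊎ (u ≡ next w × HasBwd (C w))

Path : ∀ {n} → CycleGraph n → Fin n → Fin n → Set
Path C = Star (Arrow C)

Sink : ∀ {n} → CycleGraph n → Fin n → Set
Sink C v = ∀ w → ¬ Arrow C v w

GlobalSink : ∀ {n} → CycleGraph n → Fin n → Set
GlobalSink C v = Sink C v × (∀ u → u ≢ v → Path C u v)

-- A double chain of length k ≥ 1 contained in C: distinct vertices
-- v 0, …, v (k+1) of C such that the arrows of C between consecutive v j, v (j+1)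
-- (edge number j, 0 ≤ j ≤ k) are exactly those of a double chain:
--   v (j+1) → v j  iff  j < k,     v j → v (j+1)  iff  1 ≤ j.
-- (So edge 0 is v1 → v0 only, edges 1..k-1 are bi-directional, edge k is vk → vk+1 only.)
record DoubleChain {n} (C : CycleGraph n) : Set where
  field
    k     : ℕ
    k≥1   : 1 ≤ k
    v     : Fin (suc (suc k)) → Fin n
    v-inj : ∀ i j → v i ≡ v j → i ≡ j
    back  : ∀ (j : Fin (suc k)) → Arrow C (v (fsuc j)) (v (inject₁ j)) ⇔ (toℕ j < k)
    forth : ∀ (j : Fin (suc k)) → Arrow C (v (inject₁ j)) (v (fsuc j)) ⇔ (1 ≤ toℕ j)

open DoubleChain

InVertices : ∀ {n} {C : CycleGraph n} → DoubleChain C → Fin n → Set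
InVertices D x = ∃ λ i → v D i ≡ x

InEdges : ∀ {n} {C : CycleGraph n} → DoubleChain C → Fin n → Fin n → Set
InEdges D x y = ∃ λ (j : Fin (suc (k D))) →
  (v D (inject₁ j) ≡ x × v D (fsuc j) ≡ y) ⊎ (v D (inject₁ j) ≡ y × v D (fsuc j) ≡ x)

-- D and E are the same subgraph of C (same vertices, same edges; the arrows on
-- them are then those of C)
SameSubgraph : ∀ {n} {C : CycleGraph n} → DoubleChain C → DoubleChain C → Set
SameSubgraph D E = (∀ x → InVertices D x ⇔ InVertices E x)
                 × (∀ x y → InEdges D x y ⇔ InEdges E x y)

-- Number the edges of the cycle by their distance from the global sink s, so that edge j joins
-- the vertices j and j + 1 steps after s.  If some edge P has no backward arrow and a later edge
-- Q < n has no forward arrow, the arc of vertices P + 1, …, Q is closed under arrows and misses s,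
-- which is impossible since s is reachable from every vertex.  A double chain, traversed in the
-- direction in which its first edge points back, occupies edges b, …, b + k whose first edge has
-- no forward arrow, whose later edges all have one, and whose last edge has no backward arrow.
-- A second such chain cannot start inside the first (its first edge lacks a forward arrow) nor
-- after it (edges b + k and b′ would bound a closed arc), so b and k, hence the subgraph, are
-- determined.

module Submission where

open import Defs
open import Data.Nat using (ℕ; zero; suc; _+_; _∸_; _≤_; _<_; z≤n; s≤s; s≤s⁻¹; _%_; NonZero; _≤?_)
open import Data.Nat.Properties
open import Data.Nat.DivMod using (_mod_; %-distribˡ-+; [m+n]%n≡m%n; m<n⇒m%n≡m; m%n%n≡m%n; m%n<n)
open import Data.Fin using (Fin; toℕ; fromℕ<; inject₁) renaming (suc to fsuc)
open import Data.Fin.Properties using (toℕ-injective; toℕ-fromℕ<; toℕ<n; toℕ-inject₁)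
open import Data.Product using (∃; _×_; _,_)
open import Data.Sum using (_⊎_; inj₁; inj₂; swap)
open import Data.Empty using (⊥; ⊥-elim)
open import Function using (_∘_)
open import Function.Bundles using (_⇔_; mk⇔; Equivalence)
open import Function.Properties.Equivalence using (⇔-setoid) renaming (sym to ⇔-sym; trans to ⇔-trans)
open import Relation.Binary.Construct.Closure.ReflexiveTransitive using (ε; _◅_)
open import Level using (0ℓ)
import Relation.Binary.Reasoning.Setoid as SetoidReasoning
open import Relation.Binary.PropositionalEquality
open import Relation.Nullary using (¬_; yes; no)
open import Relation.Binary.Definitions using (tri<; tri≈; tri>)

module ⇔-Reasoning = SetoidReasoning (⇔-setoid 0ℓ)

[m+n%o]%o≡[m+n]%o : ∀ m n o .{{_ : NonZero o}} → (m + n % o) % o ≡ (m + n) % o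
[m+n%o]%o≡[m+n]%o m n o = begin
  (m + n % o) % o            ≡⟨ %-distribˡ-+ m (n % o) o ⟩
  (m % o + n % o % o) % o    ≡⟨ cong (λ r → (m % o + r) % o) (m%n%n≡m%n n o) ⟩
  (m % o + n % o) % o        ≡⟨ %-distribˡ-+ m n o ⟨
  (m + n) % o                ∎
  where open ≡-Reasoning

[1+m]%o≡[1+n]%o⇒m%o≡n%o : ∀ {m n o} .{{_ : NonZero o}} → suc m % o ≡ suc n % o → m % o ≡ n % o
[1+m]%o≡[1+n]%o⇒m%o≡n%o {m} {n} {o@(suc p)} eq = begin
  m % o                       ≡⟨ [m+n]%n≡m%n m o ⟨
  (m + o) % o                 ≡⟨ cong (_% o) (+-suc m p) ⟩
  (suc m + p) % o             ≡⟨ %-distribˡ-+ (suc m) p o ⟩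
  (suc m % o + p % o) % o     ≡⟨ cong (λ r → (r + p % o) % o) eq ⟩
  (suc n % o + p % o) % o     ≡⟨ %-distribˡ-+ (suc n) p o ⟨
  (suc n + p) % o             ≡⟨ cong (_% o) (+-suc n p) ⟨
  (n + o) % o                 ≡⟨ [m+n]%n≡m%n n o ⟩
  n % o                       ∎
  where open ≡-Reasoning

[m+n]%o≡[m+k]%o⇒n%o≡k%o : ∀ m {n k o} .{{_ : NonZero o}} → (m + n) % o ≡ (m + k) % o → n % o ≡ k % o
[m+n]%o≡[m+k]%o⇒n%o≡k%o zero    eq = eq
[m+n]%o≡[m+k]%o⇒n%o≡k%o (suc m) eq = [m+n]%o≡[m+k]%o⇒n%o≡k%o m ([1+m]%o≡[1+n]%o⇒m%o≡n%o eq)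

toℕ-next : ∀ {m} (x : Fin (suc m)) → toℕ (next x) ≡ suc (toℕ x) % suc m
toℕ-next x = toℕ-fromℕ< _

toℕ-onto : ∀ {j m} → j < m → ∃ λ (J : Fin m) → toℕ J ≡ j
toℕ-onto j<m = fromℕ< j<m , toℕ-fromℕ< j<m

next-injective : ∀ {n} {x y : Fin n} → next x ≡ next y → x ≡ y
next-injective {suc m} {x} {y} eq = toℕ-injective (begin
  toℕ x            ≡⟨ m<n⇒m%n≡m (toℕ<n x) ⟨
  toℕ x % suc m    ≡⟨ [1+m]%o≡[1+n]%o⇒m%o≡n%o {toℕ x} {toℕ y}
                        (trans (sym (toℕ-next x)) (trans (cong toℕ eq) (toℕ-next y))) ⟩
  toℕ y % suc m    ≡⟨ m<n⇒m%n≡m (toℕ<n y) ⟩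
  toℕ y            ∎)
  where open ≡-Reasoning

module _ {m : ℕ} (s : Fin (suc m)) where

  vertexAt : ℕ → Fin (suc m)
  vertexAt j = (toℕ s + j) mod suc m

  toℕ-vertexAt : ∀ j → toℕ (vertexAt j) ≡ (toℕ s + j) % suc m
  toℕ-vertexAt j = toℕ-fromℕ< _

  next-vertexAt : ∀ j → next (vertexAt j) ≡ vertexAt (suc j)
  next-vertexAt j = toℕ-injective (begin
    toℕ (next (vertexAt j))          ≡⟨ toℕ-next (vertexAt j) ⟩
    suc (toℕ (vertexAt j)) % suc m   ≡⟨ cong (λ r → suc r % suc m) (toℕ-vertexAt j) ⟩
    (1 + (toℕ s + j) % suc m) % suc m ≡⟨ [m+n%o]%o≡[m+n]%o 1 (toℕ s + j) (suc m) ⟩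
    suc (toℕ s + j) % suc m          ≡⟨ cong (_% suc m) (+-suc (toℕ s) j) ⟨
    (toℕ s + suc j) % suc m          ≡⟨ toℕ-vertexAt (suc j) ⟨
    toℕ (vertexAt (suc j))           ∎)
    where open ≡-Reasoning

  vertexAt-injective : ∀ {i j} → i < suc m → j < suc m → vertexAt i ≡ vertexAt j → i ≡ j
  vertexAt-injective {i} {j} i<n j<n eq = begin
    i            ≡⟨ m<n⇒m%n≡m i<n ⟨
    i % suc m    ≡⟨ [m+n]%o≡[m+k]%o⇒n%o≡k%o (toℕ s) {i} {j}
                      (trans (sym (toℕ-vertexAt i)) (trans (cong toℕ eq) (toℕ-vertexAt j))) ⟩
    j % suc m    ≡⟨ m<n⇒m%n≡m j<n ⟩
    j            ∎
    where open ≡-Reasoning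

  vertexAt-zero : vertexAt 0 ≡ s
  vertexAt-zero = toℕ-injective (trans (toℕ-vertexAt 0)
    (trans (cong (_% suc m) (+-identityʳ (toℕ s))) (m<n⇒m%n≡m (toℕ<n s))))

  vertexAt-surjective : ∀ x → ∃ λ j → j < suc m × vertexAt j ≡ x
  vertexAt-surjective x = j , m%n<n (d + toℕ x) (suc m) , toℕ-injective (begin
    toℕ (vertexAt j)                          ≡⟨ toℕ-vertexAt j ⟩
    (toℕ s + j) % suc m                       ≡⟨ [m+n%o]%o≡[m+n]%o (toℕ s) (d + toℕ x) (suc m) ⟩
    (toℕ s + (d + toℕ x)) % suc m             ≡⟨ cong (_% suc m) (+-assoc (toℕ s) d (toℕ x)) ⟨
    (toℕ s + d + toℕ x) % suc m               ≡⟨ cong (λ r → (r + toℕ x) % suc m) (m+[n∸m]≡n (<⇒≤ (toℕ<n s))) ⟩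
    (suc m + toℕ x) % suc m                   ≡⟨ cong (_% suc m) (+-comm (suc m) (toℕ x)) ⟩
    (toℕ x + suc m) % suc m                   ≡⟨ [m+n]%n≡m%n (toℕ x) (suc m) ⟩
    toℕ x % suc m                             ≡⟨ m<n⇒m%n≡m (toℕ<n x) ⟩
    toℕ x                                     ∎)
    where
      open ≡-Reasoning
      d = suc m ∸ toℕ s
      j = (d + toℕ x) % suc m

next∘next≢id : ∀ {n} → 3 ≤ n → (x : Fin n) → next (next x) ≢ x
next∘next≢id {suc m} (s≤s 2≤m) x eq = 1+n≢0 (vertexAt-injective x (s≤s 2≤m) (s≤s z≤n) (begin
  vertexAt x 2                   ≡⟨ next-vertexAt x 1 ⟨
  next (vertexAt x 1)            ≡⟨ cong next (next-vertexAt x 0) ⟨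
  next (next (vertexAt x 0))     ≡⟨ cong (next ∘ next) (vertexAt-zero x) ⟩
  next (next x)                  ≡⟨ eq ⟩
  x                              ≡⟨ vertexAt-zero x ⟨
  vertexAt x 0                   ∎))
  where open ≡-Reasoning

Adjacent : ∀ {n} → Fin n → Fin n → Set
Adjacent u w = w ≡ next u ⊎ u ≡ next w

Arrow⇒Adjacent : ∀ {n} {C : CycleGraph n} {u w} → Arrow C u w → Adjacent u w
Arrow⇒Adjacent (inj₁ (eq , _)) = inj₁ eq
Arrow⇒Adjacent (inj₂ (eq , _)) = inj₂ eq

module _ {n} (3≤n : 3 ≤ n) (C : CycleGraph n) where

  Arrow-to-next⇔HasFwd : ∀ u → Arrow C u (next u) ⇔ HasFwd (C u)
  Arrow-to-next⇔HasFwd u = mk⇔ to (λ f → inj₁ (refl , f))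
    where
      to : Arrow C u (next u) → HasFwd (C u)
      to (inj₁ (_ , f))  = f
      to (inj₂ (eq , _)) = ⊥-elim (next∘next≢id 3≤n u (sym eq))

  Arrow-from-next⇔HasBwd : ∀ u → Arrow C (next u) u ⇔ HasBwd (C u)
  Arrow-from-next⇔HasBwd u = mk⇔ to (λ b → inj₂ (refl , b))
    where
      to : Arrow C (next u) u → HasBwd (C u)
      to (inj₁ (eq , _)) = ⊥-elim (next∘next≢id 3≤n u (sym eq))
      to (inj₂ (_ , b))  = b

SameEdge : ∀ {n} → Fin n → Fin n → Fin n → Fin n → Set
SameEdge a b x y = (a ≡ x × b ≡ y) ⊎ (a ≡ y × b ≡ x)

SameEdge-flip : ∀ {n} {a b x y : Fin n} → SameEdge a b x y → SameEdge b a x y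
SameEdge-flip (inj₁ (a≡x , b≡y)) = inj₂ (b≡y , a≡x)
SameEdge-flip (inj₂ (a≡y , b≡x)) = inj₁ (b≡x , a≡y)

VertexOf : ∀ {n} → ℕ → (ℕ → Fin n) → Fin n → Set
VertexOf k w x = ∃ λ j → j ≤ suc k × w j ≡ x

EdgeOf : ∀ {n} → ℕ → (ℕ → Fin n) → Fin n → Fin n → Set
EdgeOf k w x y = ∃ λ j → j ≤ k × SameEdge (w j) (w (suc j)) x y

module _ {n} {k : ℕ} {w u : ℕ → Fin n} (w≗u : ∀ j → j ≤ suc k → w j ≡ u j) where

  VertexOf-cong : ∀ {x} → VertexOf k w x → VertexOf k u x
  VertexOf-cong (j , j≤ , eq) = j , j≤ , trans (sym (w≗u j j≤)) eq

  EdgeOf-cong : ∀ {x y} → EdgeOf k w x y → EdgeOf k u x y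
  EdgeOf-cong (j , j≤ , e) =
    j , j≤ , subst₂ (λ a b → SameEdge a b _ _) (w≗u j (m≤n⇒m≤1+n j≤)) (w≗u (suc j) (s≤s j≤)) e

reverse : ∀ {n} → ℕ → (ℕ → Fin n) → ℕ → Fin n
reverse k w j = w (suc k ∸ j)

∸-suc : ∀ {j k} → j ≤ k → suc k ∸ j ≡ suc (k ∸ j)
∸-suc = +-∸-assoc 1

module _ {n} {k : ℕ} {w : ℕ → Fin n} where

  reverse-involutive : ∀ j → j ≤ suc k → reverse k (reverse k w) j ≡ w j
  reverse-involutive j j≤ = cong w (m∸[m∸n]≡n j≤)

  VertexOf-reverse : ∀ {x} → VertexOf k w x → VertexOf k (reverse k w) x
  VertexOf-reverse (j , j≤ , eq) = suc k ∸ j , m∸n≤m (suc k) j , trans (reverse-involutive j j≤) eq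

  EdgeOf-reverse : ∀ {x y} → EdgeOf k w x y → EdgeOf k (reverse k w) x y
  EdgeOf-reverse (j , j≤ , e) = k ∸ j , m∸n≤m k j ,
    subst₂ (λ a b → SameEdge a b _ _) (sym start) (sym end) (SameEdge-flip e)
    where
      start : reverse k w (k ∸ j) ≡ w (suc j)
      start = cong w (trans (∸-suc (m∸n≤m k j)) (cong suc (m∸[m∸n]≡n j≤)))
      end : reverse k w (suc (k ∸ j)) ≡ w j
      end = cong w (m∸[m∸n]≡n j≤)

Ascending : ∀ {n} → ℕ → (ℕ → Fin n) → Set
Ascending k w = ∀ j → j ≤ k → w (suc j) ≡ next (w j)

Descending : ∀ {n} → ℕ → (ℕ → Fin n) → Set
Descending k w = ∀ j → j ≤ k → w j ≡ next (w (suc j))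

Descending-reverse : ∀ {n k} {w : ℕ → Fin n} → Descending k w → Ascending k (reverse k w)
Descending-reverse {k = k} {w} desc j j≤ =
  trans (desc (k ∸ j) (m∸n≤m k j)) (cong (next ∘ w) (sym (∸-suc j≤)))

module _ {A : Set} (R : A → A → Set) (R-injective : ∀ {a b c} → R a c → R b c → a ≡ b) where

  steps-agree : ∀ {k} (w : ℕ → A) →
                (∀ {i j} → i ≤ suc k → j ≤ suc k → w i ≡ w j → i ≡ j) →
                (∀ j → j ≤ k → R (w j) (w (suc j)) ⊎ R (w (suc j)) (w j)) →
                R (w 0) (w 1) → ∀ j → j ≤ k → R (w j) (w (suc j))
  -- A step against R would give R (w j) (w (j + 1)) and R (w (j + 2)) (w (j + 1)), so w revisits w j.
  steps-agree w inj step first zero    _     = first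
  steps-agree w inj step first (suc j) 1+j≤k with step (suc j) 1+j≤k
  ... | inj₁ r = r
  ... | inj₂ r = ⊥-elim (<⇒≢ (s≤s (n≤1+n j)) (inj (m≤n⇒m≤1+n (<⇒≤ 1+j≤k)) (s≤s 1+j≤k)
                   (R-injective (steps-agree w inj step first j (<⇒≤ 1+j≤k)) r)))

module _ {n} (C : CycleGraph n) where

  record ChainWalk (k : ℕ) (w : ℕ → Fin n) : Set where
    field
      injective : ∀ {i j} → i ≤ suc k → j ≤ suc k → w i ≡ w j → i ≡ j
      back      : ∀ j → j ≤ k → Arrow C (w (suc j)) (w j) ⇔ j < k
      forth     : ∀ j → j ≤ k → Arrow C (w j) (w (suc j)) ⇔ 1 ≤ j

  module _ {k w} (walk : ChainWalk k w) where
    open ChainWalk walk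

    ChainWalk-reverse : ChainWalk k (reverse k w)
    ChainWalk-reverse = record
      { injective = λ {i} {j} i≤ j≤ eq →
                      ∸-cancelˡ-≡ i≤ j≤ (injective (m∸n≤m (suc k) i) (m∸n≤m (suc k) j) eq)
      ; back      = back′
      ; forth     = forth′
      }
      where
        open ⇔-Reasoning

        back′ : ∀ j → j ≤ k → Arrow C (w (k ∸ j)) (w (suc k ∸ j)) ⇔ j < k
        back′ j j≤ = begin
          Arrow C (w (k ∸ j)) (w (suc k ∸ j))     ≡⟨ cong (Arrow C (w (k ∸ j)) ∘ w) (∸-suc j≤) ⟩
          Arrow C (w (k ∸ j)) (w (suc (k ∸ j)))   ≈⟨ forth (k ∸ j) (m∸n≤m k j) ⟩
          1 ≤ k ∸ j                               ≈⟨ mk⇔ (λ 1≤ → m∸n≢0⇒n<m (<⇒≢ 1≤ ∘ sym)) m<n⇒0<n∸m ⟩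
          j < k                                   ∎

        forth′ : ∀ j → j ≤ k → Arrow C (w (suc k ∸ j)) (w (k ∸ j)) ⇔ 1 ≤ j
        forth′ j j≤ = begin
          Arrow C (w (suc k ∸ j)) (w (k ∸ j))     ≡⟨ cong (λ i → Arrow C (w i) (w (k ∸ j))) (∸-suc j≤) ⟩
          Arrow C (w (suc (k ∸ j))) (w (k ∸ j))   ≈⟨ back (k ∸ j) (m∸n≤m k j) ⟩
          k ∸ j < k                               ≈⟨ mk⇔ ∸-cancelʳ-< (λ 1≤j → ∸-monoʳ-< 1≤j j≤) ⟩
          1 ≤ j                                   ∎

    adjacent : 1 ≤ k → ∀ j → j ≤ k → Adjacent (w j) (w (suc j))
    adjacent 1≤k zero    _  = swap (Arrow⇒Adjacent {C = C} (Equivalence.from (back 0 z≤n) 1≤k))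
    adjacent _   (suc j) j≤ = Arrow⇒Adjacent {C = C} (Equivalence.from (forth (suc j) j≤) (s≤s z≤n))

    orientation : 1 ≤ k → Ascending k w ⊎ Descending k w
    orientation 1≤k with adjacent 1≤k 0 z≤n
    ... | inj₁ up   = inj₁ (steps-agree (λ a b → b ≡ next a) (λ p q → next-injective (trans (sym p) q))
                             w injective (adjacent 1≤k) up)
    ... | inj₂ down = inj₂ (steps-agree (λ a b → a ≡ next b) (λ p q → trans p (sym q))
                             w injective (λ j j≤ → swap (adjacent 1≤k j j≤)) down)

  record Spans (D : DoubleChain C) (k : ℕ) (w : ℕ → Fin n) : Set where
    field
      vertices : ∀ x → InVertices D x ⇔ VertexOf k w x
      edges    : ∀ x y → InEdges D x y ⇔ EdgeOf k w x y

  module _ {D k w} (spans : Spans D k w) where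
    open Spans spans

    Spans-cong : ∀ {u} → (∀ j → j ≤ suc k → w j ≡ u j) → Spans D k u
    Spans-cong w≗u = record
      { vertices = λ x → mk⇔ (VertexOf-cong w≗u ∘ Equivalence.to (vertices x))
                             (Equivalence.from (vertices x) ∘ VertexOf-cong (λ j j≤ → sym (w≗u j j≤)))
      ; edges    = λ x y → mk⇔ (EdgeOf-cong w≗u ∘ Equivalence.to (edges x y))
                               (Equivalence.from (edges x y) ∘ EdgeOf-cong (λ j j≤ → sym (w≗u j j≤)))
      }

    Spans-reverse : Spans D k (reverse k w)
    Spans-reverse = record
      { vertices = λ x → mk⇔ (VertexOf-reverse ∘ Equivalence.to (vertices x))
                             (Equivalence.from (vertices x) ∘ VertexOf-cong reverse-involutive ∘ VertexOf-reverse)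
      ; edges    = λ x y → mk⇔ (EdgeOf-reverse ∘ Equivalence.to (edges x y))
                               (Equivalence.from (edges x y) ∘ EdgeOf-cong reverse-involutive ∘ EdgeOf-reverse)
      }

  Spans-same : ∀ {D E k w} → Spans D k w → Spans E k w → SameSubgraph D E
  Spans-same D-spans E-spans =
      (λ x → ⇔-trans (vertices D-spans x) (⇔-sym (vertices E-spans x)))
    , (λ x y → ⇔-trans (edges D-spans x y) (⇔-sym (edges E-spans x y)))
    where open Spans

  module _ (D : DoubleChain C) where
    open DoubleChain D

    -- Indices past k + 1 wrap around; only 0, …, k + 1 are ever used.
    chainVertex : ℕ → Fin n
    chainVertex j = v (j mod suc (suc k))

    chainVertex-toℕ : ∀ i → chainVertex (toℕ i) ≡ v i
    chainVertex-toℕ i = cong v (toℕ-injective (trans (toℕ-fromℕ< _) (m<n⇒m%n≡m (toℕ<n i))))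

    chainVertex-inject₁ : ∀ i → chainVertex (toℕ i) ≡ v (inject₁ i)
    chainVertex-inject₁ i = trans (cong chainVertex (sym (toℕ-inject₁ i))) (chainVertex-toℕ (inject₁ i))

    chainVertex-walk : ChainWalk k chainVertex
    chainVertex-walk = record
      { injective = injective′
      ; back      = back′
      ; forth     = forth′
      }
      where
        injective′ : ∀ {i j} → i ≤ suc k → j ≤ suc k → chainVertex i ≡ chainVertex j → i ≡ j
        injective′ {i} {j} i≤ j≤ eq = begin
          i                         ≡⟨ m<n⇒m%n≡m (s≤s i≤) ⟨
          i % suc (suc k)           ≡⟨ toℕ-fromℕ< _ ⟨
          toℕ (i mod suc (suc k))   ≡⟨ cong toℕ (v-inj _ _ eq) ⟩
          toℕ (j mod suc (suc k))   ≡⟨ toℕ-fromℕ< _ ⟩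
          j % suc (suc k)           ≡⟨ m<n⇒m%n≡m (s≤s j≤) ⟩
          j                         ∎
          where open ≡-Reasoning
        back′ : ∀ j → j ≤ k → Arrow C (chainVertex (suc j)) (chainVertex j) ⇔ j < k
        back′ j j≤ with J , refl ← toℕ-onto (s≤s j≤) =
          subst₂ (λ a b → Arrow C a b ⇔ toℕ J < k)
                 (sym (chainVertex-toℕ (fsuc J))) (sym (chainVertex-inject₁ J)) (back J)
        forth′ : ∀ j → j ≤ k → Arrow C (chainVertex j) (chainVertex (suc j)) ⇔ 1 ≤ j
        forth′ j j≤ with J , refl ← toℕ-onto (s≤s j≤) =
          subst₂ (λ a b → Arrow C a b ⇔ 1 ≤ toℕ J)
                 (sym (chainVertex-inject₁ J)) (sym (chainVertex-toℕ (fsuc J))) (forth J)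

    chainVertex-spans : Spans D k chainVertex
    chainVertex-spans = record
      { vertices = λ x → mk⇔ vertex-to vertex-from
      ; edges    = λ x y → mk⇔ edge-to edge-from
      }
      where
        vertex-to : ∀ {x} → InVertices D x → VertexOf k chainVertex x
        vertex-to (i , eq) = toℕ i , s≤s⁻¹ (toℕ<n i) , trans (chainVertex-toℕ i) eq
        vertex-from : ∀ {x} → VertexOf k chainVertex x → InVertices D x
        vertex-from (j , j≤ , eq) with J , refl ← toℕ-onto (s≤s j≤) =
          J , trans (sym (chainVertex-toℕ J)) eq
        edge-to : ∀ {x y} → InEdges D x y → EdgeOf k chainVertex x y
        edge-to (J , e) = toℕ J , s≤s⁻¹ (toℕ<n J) ,
          subst₂ (λ a b → SameEdge a b _ _) (sym (chainVertex-inject₁ J)) (sym (chainVertex-toℕ (fsuc J))) e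
        edge-from : ∀ {x y} → EdgeOf k chainVertex x y → InEdges D x y
        edge-from (j , j≤ , e) with J , refl ← toℕ-onto (s≤s j≤) =
          J , subst₂ (λ a b → SameEdge a b _ _) (chainVertex-inject₁ J) (chainVertex-toℕ (fsuc J)) e

  ascending-walk : (D : DoubleChain C) → let k = DoubleChain.k D in
                   ∃ λ w → ChainWalk k w × Ascending k w × Spans D k w
  ascending-walk D with orientation (chainVertex-walk D) (DoubleChain.k≥1 D)
  ... | inj₁ up   = chainVertex D , chainVertex-walk D , up , chainVertex-spans D
  ... | inj₂ down = reverse _ (chainVertex D) , ChainWalk-reverse (chainVertex-walk D) ,
                    Descending-reverse down , Spans-reverse (chainVertex-spans D)

module _ {m} (C : CycleGraph (suc m)) (s : Fin (suc m)) (reach : ∀ u → u ≢ s → Path C u s) where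

  label : ℕ → Dir
  label j = C (vertexAt s j)

  Arc : ℕ → ℕ → Fin (suc m) → Set
  Arc P Q x = ∃ λ j → P < j × j ≤ Q × vertexAt s j ≡ x

  vertexAt≢s : ∀ {j} → 0 < j → j < suc m → vertexAt s j ≢ s
  vertexAt≢s 0<j j<n eq =
    <⇒≢ 0<j (sym (vertexAt-injective s j<n (s≤s z≤n) (trans eq (sym (vertexAt-zero s)))))

  module _ {P Q} (closedˡ : ¬ HasBwd (label P)) (closedʳ : ¬ HasFwd (label Q)) where

    Arc-closed : ∀ {x y} → Arc P Q x → Arrow C x y → Arc P Q y
    Arc-closed (j , P<j , j≤Q , refl) (inj₁ (refl , f)) with m≤n⇒m<n∨m≡n j≤Q
    ... | inj₁ j<Q  = suc j , m<n⇒m<1+n P<j , j<Q , sym (next-vertexAt s j)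
    ... | inj₂ refl = ⊥-elim (closedʳ f)
    Arc-closed (suc j , P<1+j , j<Q , refl) (inj₂ (eq , b))
      with refl ← next-injective (trans (next-vertexAt s j) eq) with m≤n⇒m<n∨m≡n (s≤s⁻¹ P<1+j)
    ... | inj₁ P<j  = j , P<j , <⇒≤ j<Q , refl
    ... | inj₂ refl = ⊥-elim (closedˡ b)

    Arc-closed⋆ : ∀ {x y} → Arc P Q x → Path C x y → Arc P Q y
    Arc-closed⋆ x∈ ε       = x∈
    Arc-closed⋆ x∈ (a ◅ p) = Arc-closed⋆ (Arc-closed x∈ a) p

    no-closed-arc : P < Q → Q < suc m → ⊥
    no-closed-arc P<Q Q<n
      with Arc-closed⋆ (Q , P<Q , ≤-refl , refl) (reach _ (vertexAt≢s (m<n⇒0<n P<Q) Q<n))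
    ... | j , P<j , j≤Q , eq = vertexAt≢s (m<n⇒0<n P<j) (≤-<-trans j≤Q Q<n) eq

  record DoubleChainAt (b k : ℕ) : Set where
    field
      b<n     : b < suc m
      has-fwd : ∀ t → t ≤ k → HasFwd (label (b + t)) ⇔ 1 ≤ t
      has-bwd : ∀ t → t ≤ k → HasBwd (label (b + t)) ⇔ t < k

    first-¬fwd : ¬ HasFwd (label b)
    first-¬fwd f
      with () ← Equivalence.to (has-fwd 0 z≤n) (subst (HasFwd ∘ label) (sym (+-identityʳ b)) f)

    last-¬bwd : ¬ HasBwd (label (b + k))
    last-¬bwd = <-irrefl refl ∘ Equivalence.to (has-bwd k ≤-refl)

    inner-fwd : ∀ {t} → 1 ≤ t → t ≤ k → HasFwd (label (b + t))
    inner-fwd 1≤t t≤k = Equivalence.from (has-fwd _ t≤k) 1≤t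

  open DoubleChainAt

  DoubleChainAt-length-unique : ∀ {b k k′} → DoubleChainAt b k → DoubleChainAt b k′ → k ≡ k′
  DoubleChainAt-length-unique {b} {k} {k′} at at′ with <-cmp k k′
  ... | tri< k<k′ _ _ = ⊥-elim (last-¬bwd at (Equivalence.from (has-bwd at′ k (<⇒≤ k<k′)) k<k′))
  ... | tri≈ _ k≡k′ _ = k≡k′
  ... | tri> _ _ k′<k = ⊥-elim (last-¬bwd at′ (Equivalence.from (has-bwd at k′ (<⇒≤ k′<k)) k′<k))

  DoubleChainAt-¬start< : ∀ {b k b′ k′} → DoubleChainAt b k → DoubleChainAt b′ k′ → ¬ b < b′
  DoubleChainAt-¬start< {b} {k} {b′} at at′ b<b′ with b′ ≤? b + k
  ... | yes b′≤b+k = first-¬fwd at′ (subst (HasFwd ∘ label) (m+[n∸m]≡n (<⇒≤ b<b′))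
                       (inner-fwd at (m<n⇒0<n∸m b<b′) (m≤n+o⇒m∸n≤o b′ b b′≤b+k)))
  ... | no  b′≰b+k = no-closed-arc (last-¬bwd at) (first-¬fwd at′) (≰⇒> b′≰b+k) (b<n at′)

  DoubleChainAt-unique : ∀ {b k b′ k′} → DoubleChainAt b k → DoubleChainAt b′ k′ → b ≡ b′ × k ≡ k′
  DoubleChainAt-unique {b} {_} {b′} at at′ with <-cmp b b′
  ... | tri< b<b′ _ _ = ⊥-elim (DoubleChainAt-¬start< at at′ b<b′)
  ... | tri≈ _ refl _ = refl , DoubleChainAt-length-unique at at′
  ... | tri> _ _ b′<b = ⊥-elim (DoubleChainAt-¬start< at′ at b′<b)

  Ascending-vertexAt : ∀ {k w a} → Ascending k w → w 0 ≡ vertexAt s a →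
                       ∀ j → j ≤ suc k → w j ≡ vertexAt s (a + j)
  Ascending-vertexAt {a = a} _ w0≡ zero _ = trans w0≡ (cong (vertexAt s) (sym (+-identityʳ a)))
  Ascending-vertexAt {w = w} {a} up w0≡ (suc j) j≤ = begin
    w (suc j)                    ≡⟨ up j (s≤s⁻¹ j≤) ⟩
    next (w j)                   ≡⟨ cong next (Ascending-vertexAt up w0≡ j (m≤n⇒m≤1+n (s≤s⁻¹ j≤))) ⟩
    next (vertexAt s (a + j))    ≡⟨ next-vertexAt s (a + j) ⟩
    vertexAt s (suc (a + j))     ≡⟨ cong (vertexAt s) (+-suc a j) ⟨
    vertexAt s (a + suc j)       ∎
    where open ≡-Reasoning

  module _ (3≤n : 3 ≤ suc m) where

    Ascending-DoubleChainAt : ∀ {k w a} → ChainWalk C k w → Ascending k w →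
                              (∀ j → j ≤ suc k → w j ≡ vertexAt s (a + j)) → a < suc m → DoubleChainAt a k
    Ascending-DoubleChainAt {k} {w} {a} walk up w≗ a<n = record
      { b<n = a<n ; has-fwd = has-fwd′ ; has-bwd = has-bwd′ }
      where
        open ChainWalk walk
        open ⇔-Reasoning

        label≡ : ∀ t → t ≤ k → label (a + t) ≡ C (w t)
        label≡ t t≤k = cong C (sym (w≗ t (m≤n⇒m≤1+n t≤k)))

        has-fwd′ : ∀ t → t ≤ k → HasFwd (label (a + t)) ⇔ 1 ≤ t
        has-fwd′ t t≤k = begin
          HasFwd (label (a + t))          ≡⟨ cong HasFwd (label≡ t t≤k) ⟩
          HasFwd (C (w t))                ≈⟨ Arrow-to-next⇔HasFwd 3≤n C (w t) ⟨
          Arrow C (w t) (next (w t))      ≡⟨ cong (Arrow C (w t)) (up t t≤k) ⟨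
          Arrow C (w t) (w (suc t))       ≈⟨ forth t t≤k ⟩
          1 ≤ t                           ∎

        has-bwd′ : ∀ t → t ≤ k → HasBwd (label (a + t)) ⇔ t < k
        has-bwd′ t t≤k = begin
          HasBwd (label (a + t))          ≡⟨ cong HasBwd (label≡ t t≤k) ⟩
          HasBwd (C (w t))                ≈⟨ Arrow-from-next⇔HasBwd 3≤n C (w t) ⟨
          Arrow C (next (w t)) (w t)      ≡⟨ cong (λ x → Arrow C x (w t)) (up t t≤k) ⟨
          Arrow C (w (suc t)) (w t)       ≈⟨ back t t≤k ⟩
          t < k                           ∎

    placement : (D : DoubleChain C) → let k = DoubleChain.k D in
                ∃ λ a → DoubleChainAt a k × Spans C D k (vertexAt s ∘ (a +_))
    placement D with ascending-walk C D
    ... | w , walk , up , spans with vertexAt-surjective s (w 0)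
    ... | a , a<n , wa≡ = a , Ascending-DoubleChainAt walk up w≗ a<n , Spans-cong C spans w≗
      where
        w≗ : ∀ j → j ≤ suc (DoubleChain.k D) → w j ≡ vertexAt s (a + j)
        w≗ = Ascending-vertexAt up (sym wa≡)

lemma4p20 : (n : ℕ) → 3 ≤ n → (C : CycleGraph n) → ∃ (GlobalSink C) →
            (D E : DoubleChain C) → SameSubgraph D E
lemma4p20 zero () _ _
lemma4p20 (suc m) 3≤n C (s , _ , reach) D E
  with placement C s reach 3≤n D | placement C s reach 3≤n E
... | a , D-at , D-spans | a′ , E-at , E-spans with DoubleChainAt-unique C s reach D-at E-at
... | refl , k≡k′ = Spans-same C D-spans (subst (λ k → Spans C E k _) (sym k≡k′) E-spans)
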